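{- Let $a_{n,k,\ell}$ be the number of paths in $\mathcal{A}_n$ having $k$ up-steps $U$ and $\ell$ down-steps $D=D_1$, and $A(x,y,z)=\sum_{n,k,\ell\geq 0}a_{n,k,\ell}x^ny^kz^\ell$. Then $$A(x,y,z)=\frac{1-xy-x^2yz-2x^3y^2+2x^3y^2z-\sqrt{R}}{2xy\left(1+x^2y-x^2yz\right)},$$ where $R=x^4y^2z^2+2x^3y^2z-4x^3y^2+x^2y^2-2x^2yz-2xy+1$.
   Context: A Dyck path with air pockets is a non-empty lattice path in the first quadrant of $\mathbb{Z}^2$ starting at the origin, ending on the $x$-axis, consisting of up-steps $U=(1,1)$ and down-steps $D_k=(1,-k)$, $k\geq1$, where no two down-steps are consecutive; $D=D_1$. Its length is its number of steps, and $\mathcal{A}_n$ denotes the set of such paths of length $n$. -}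

module Defs where

open import Data.Nat using (ℕ; zero; suc; _∸_; _≡ᵇ_; _≤ᵇ_)
open import Data.Integer using (ℤ; +_; -_) renaming (_+_ to _+ℤ_; _*_ to _*ℤ_)
open import Data.Bool using (Bool; true; false; _∧_; if_then_else_)
open import Data.List using (List; []; _∷_; length)
open import Data.Fin using (Fin)
open import Data.Product using (Σ)
open import Data.Unit using (⊤)
open import Data.Bool using (T)
open import Relation.Binary.PropositionalEquality using (_≡_)

-- Steps of a Dyck path with air pockets.
-- up      = U = (1,1)
-- down j  = D_{j+1} = (1, -(j+1))   (so down 0 = D = D_1)

data Step : Set where
  up   : Step
  down : ℕ → Step

-- Returns true iff the path never goes
-- below the x-axis, has no two consecutive down-steps, and ends at height 0.
walk : Bool → ℕ → List Step → Bool
walk prevDown h []              = h ≡ᵇ 0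
walk prevDown h (up ∷ w)        = walk false (suc h) w
walk true     h (down j ∷ w)    = false
walk false    h (down j ∷ w)    = (suc j ≤ᵇ h) ∧ walk true (h ∸ suc j) w

isAirDyck : List Step → Bool
isAirDyck []      = false
isAirDyck (s ∷ w) = walk false 0 (s ∷ w)

countU : List Step → ℕ
countU []           = 0
countU (up ∷ w)     = suc (countU w)
countU (down _ ∷ w) = countU w

countD1 : List Step → ℕ
countD1 []                 = 0
countD1 (up ∷ w)           = countD1 w
countD1 (down zero ∷ w)    = suc (countD1 w)
countD1 (down (suc _) ∷ w) = countD1 w

good : ℕ → ℕ → ℕ → List Step → Bool
good n k ℓ w = isAirDyck w ∧ (length w ≡ᵇ n) ∧ (countU w ≡ᵇ k) ∧ (countD1 w ≡ᵇ ℓ)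

Paths : ℕ → ℕ → ℕ → Set
Paths n k ℓ = Σ (List Step) (λ w → T (good n k ℓ w))

-- Formal power series in x, y, z over ℤ:  coefficient of x^n y^k z^ℓ.

PS : Set
PS = ℕ → ℕ → ℕ → ℤ

_≈_ : PS → PS → Set
f ≈ g = ∀ n k l → f n k l ≡ g n k l

infix 4 _≈_
infixl 6 _⊕_ _⊖_
infixl 7 _⊛_

_⊕_ : PS → PS → PS
(f ⊕ g) n k l = f n k l +ℤ g n k l

⊝_ : PS → PS
(⊝ f) n k l = - (f n k l)

_⊖_ : PS → PS → PS
f ⊖ g = f ⊕ (⊝ g)

sumTo : ℕ → (ℕ → ℤ) → ℤ
sumTo zero    f = f 0
sumTo (suc n) f = sumTo n f +ℤ f (suc n)

_⊛_ : PS → PS → PS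
(f ⊛ g) n k l =
  sumTo n (λ i → sumTo k (λ j → sumTo l (λ m →
    f i j m *ℤ g (n ∸ i) (k ∸ j) (l ∸ m))))

mon : ℤ → ℕ → ℕ → ℕ → PS
mon c a b d n k l = if (a ≡ᵇ n) ∧ (b ≡ᵇ k) ∧ (d ≡ᵇ l) then c else + 0

Pnum : PS
Pnum = mon (+ 1) 0 0 0 ⊖ mon (+ 1) 1 1 0 ⊖ mon (+ 1) 2 1 1
       ⊖ mon (+ 2) 3 2 0 ⊕ mon (+ 2) 3 2 1

-- denominator 2xy(1 + x^2y - x^2yz) = 2xy + 2x^3y^2 - 2x^3y^2z
Den : PS
Den = mon (+ 2) 1 1 0 ⊕ mon (+ 2) 3 2 0 ⊖ mon (+ 2) 3 2 1

Rpoly : PS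
Rpoly = mon (+ 1) 4 2 2 ⊕ mon (+ 2) 3 2 1 ⊖ mon (+ 4) 3 2 0 ⊕ mon (+ 1) 2 2 0
        ⊖ mon (+ 2) 2 1 1 ⊖ mon (+ 2) 1 1 0 ⊕ mon (+ 1) 0 0 0

IsSqrtOf : PS → PS → Set
IsSqrtOf S R = (S ⊛ S ≈ R) Data.Product.× (S 0 0 0 ≡ + 1)

-- A path is U, then a first passage from height 1 down to the axis, then either nothing or
-- another path: A = xy·E·(1 + A).  A first passage from height 1 is a single D or starts with U;
-- the latter are exactly the first passages C from height 1 that begin right after a down-step,
-- and each is U followed by a first passage G from height 2: E = xz + C and C = xy·G.  A first
-- passage from height 2 either jumps over height 1 with its last step (shortening that step leaves
-- a first passage from height 1, weighted x + C because a final D turns into a D₂), or it first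
-- touches height 1 and continues as a C: G = x + C + E·C.  Eliminating E, C and G gives
-- lead·A² + mid·A + low = 0 with Den = 2·lead and Pnum = −mid, and completing the square shows
-- that Pnum − Den·A squares to mid² − 4·lead·low = R.
module Submission where

open import Level using (Level)
open import Data.Nat using (ℕ; zero; suc)
open import Data.Integer using (+_)
open import Data.Fin using (Fin)
open import Data.Product using (Σ; _×_; _,_; proj₁; proj₂)
open import Function using (_∘_)
open import Function.Bundles using (_↔_)
open import Algebra.Bundles using (CommutativeRing)

sumUpTo : ∀ {a} {A : Set a} → (A → A → A) → ℕ → (ℕ → A) → A
sumUpTo _+_ zero    f = f 0
sumUpTo _+_ (suc n) f = sumUpTo _+_ n f + f (suc n)

module PowerSeries {c ℓ : Level} (R : CommutativeRing c ℓ) where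

  open import Data.Nat using (_∸_; _≤_; z≤n)
  open import Data.Nat.Properties using (n∸n≡0; +-∸-assoc; m≤n⇒m≤1+n; ≤-refl)
  import Algebra.Construct.Pointwise as Pointwise
  import Relation.Binary.PropositionalEquality as ≡

  open CommutativeRing R hiding (zero)
  open import Algebra.Properties.CommutativeSemigroup +-commutativeSemigroup using (interchange)
  open import Relation.Binary.Reasoning.Setoid setoid

  Series : Set c
  Series = ℕ → Carrier

  infix 4 _≈ₛ_
  _≈ₛ_ : Series → Series → Set ℓ
  f ≈ₛ g = ∀ n → f n ≈ g n

  ∑ : ℕ → (ℕ → Carrier) → Carrier
  ∑ = sumUpTo _+_

  ∑-cong≤ : ∀ n {f g : ℕ → Carrier} → (∀ i → i ≤ n → f i ≈ g i) → ∑ n f ≈ ∑ n g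
  ∑-cong≤ zero    f≈g = f≈g 0 z≤n
  ∑-cong≤ (suc n) f≈g = +-cong (∑-cong≤ n (λ i i≤n → f≈g i (m≤n⇒m≤1+n i≤n))) (f≈g (suc n) ≤-refl)

  ∑-cong : ∀ n {f g : ℕ → Carrier} → (∀ i → f i ≈ g i) → ∑ n f ≈ ∑ n g
  ∑-cong n f≈g = ∑-cong≤ n (λ i _ → f≈g i)

  ∑-distrib-+ : ∀ n (f g : ℕ → Carrier) → ∑ n (λ i → f i + g i) ≈ ∑ n f + ∑ n g
  ∑-distrib-+ zero    f g = refl
  ∑-distrib-+ (suc n) f g = trans (+-congʳ (∑-distrib-+ n f g)) (interchange _ _ _ _)

  *-distribˡ-∑ : ∀ n x (f : ℕ → Carrier) → ∑ n (λ i → x * f i) ≈ x * ∑ n f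
  *-distribˡ-∑ zero    x f = refl
  *-distribˡ-∑ (suc n) x f = trans (+-congʳ (*-distribˡ-∑ n x f)) (sym (distribˡ x _ _))

  ∑-zero : ∀ n → ∑ n (λ _ → 0#) ≈ 0#
  ∑-zero zero    = refl
  ∑-zero (suc n) = trans (+-congʳ (∑-zero n)) (+-identityˡ 0#)

  ∑-head : ∀ n (f : ℕ → Carrier) → ∑ (suc n) f ≈ f 0 + ∑ n (λ i → f (suc i))
  ∑-head zero    f = refl
  ∑-head (suc n) f = trans (+-congʳ (∑-head n f)) (+-assoc _ _ _)

  infixl 6 _+ₛ_
  infixl 7 _*ₛ_

  _+ₛ_ : Series → Series → Series
  (f +ₛ g) n = f n + g n

  -ₛ_ : Series → Series
  (-ₛ f) n = - f n

  const : Carrier → Series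
  const x zero    = x
  const x (suc _) = 0#

  0ₛ 1ₛ X : Series
  0ₛ _ = 0#
  1ₛ   = const 1#
  X zero          = 0#
  X (suc zero)    = 1#
  X (suc (suc _)) = 0#

  _*ₛ_ : Series → Series → Series
  (f *ₛ g) n = ∑ n (λ i → f i * g (n ∸ i))

  *ₛ-cong : ∀ {f f′ g g′} → f ≈ₛ f′ → g ≈ₛ g′ → f *ₛ g ≈ₛ f′ *ₛ g′
  *ₛ-cong f≈f′ g≈g′ n = ∑-cong n (λ i → *-cong (f≈f′ i) (g≈g′ (n ∸ i)))

  *ₛ-head : ∀ n f g → (f *ₛ g) (suc n) ≈ f 0 * g (suc n) + ((λ i → f (suc i)) *ₛ g) n
  *ₛ-head n f g = ∑-head n (λ i → f i * g (suc n ∸ i))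

  *ₛ-last : ∀ n f g → (f *ₛ g) (suc n) ≈ (f *ₛ (λ i → g (suc i))) n + f (suc n) * g 0
  *ₛ-last n f g = +-cong (∑-cong≤ n (λ i i≤n → *-congˡ (reflexive (≡.cong g (+-∸-assoc 1 i≤n)))))
                         (*-congˡ (reflexive (≡.cong g (n∸n≡0 n))))

  *ₛ-distribʳ : ∀ h f g → (f +ₛ g) *ₛ h ≈ₛ f *ₛ h +ₛ g *ₛ h
  *ₛ-distribʳ h f g n = trans (∑-cong n (λ i → distribʳ (h (n ∸ i)) (f i) (g i))) (∑-distrib-+ n _ _)

  *ₛ-distribˡ : ∀ h f g → h *ₛ (f +ₛ g) ≈ₛ h *ₛ f +ₛ h *ₛ g
  *ₛ-distribˡ h f g n = trans (∑-cong n (λ i → distribˡ (h i) (f (n ∸ i)) (g (n ∸ i)))) (∑-distrib-+ n _ _)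

  *ₛ-scaleˡ : ∀ x f h → (λ i → x * f i) *ₛ h ≈ₛ (λ n → x * (f *ₛ h) n)
  *ₛ-scaleˡ x f h n = trans (∑-cong n (λ i → *-assoc x (f i) (h (n ∸ i)))) (*-distribˡ-∑ n x _)

  *ₛ-zeroˡ : ∀ h → 0ₛ *ₛ h ≈ₛ 0ₛ
  *ₛ-zeroˡ h n = trans (∑-cong n (λ i → zeroˡ (h (n ∸ i)))) (∑-zero n)

  const-*ₛ : ∀ x f → const x *ₛ f ≈ₛ (λ n → x * f n)
  const-*ₛ x f zero    = refl
  const-*ₛ x f (suc n) = begin
    (const x *ₛ f) (suc n)           ≈⟨ *ₛ-head n (const x) f ⟩
    x * f (suc n) + (0ₛ *ₛ f) n      ≈⟨ +-congˡ (*ₛ-zeroˡ f n) ⟩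
    x * f (suc n) + 0#               ≈⟨ +-identityʳ _ ⟩
    x * f (suc n)                    ∎

  *ₛ-comm : ∀ f g → f *ₛ g ≈ₛ g *ₛ f
  *ₛ-comm f g zero    = *-comm (f 0) (g 0)
  *ₛ-comm f g (suc n) = begin
    (f *ₛ g) (suc n)                              ≈⟨ *ₛ-head n f g ⟩
    f 0 * g (suc n) + ((λ i → f (suc i)) *ₛ g) n  ≈⟨ +-cong (*-comm (f 0) (g (suc n))) (*ₛ-comm _ g n) ⟩
    g (suc n) * f 0 + (g *ₛ (λ i → f (suc i))) n  ≈⟨ +-comm _ _ ⟩
    (g *ₛ (λ i → f (suc i))) n + g (suc n) * f 0  ≈⟨ *ₛ-last n g f ⟨
    (g *ₛ f) (suc n)                              ∎

  *ₛ-assoc : ∀ f g h → (f *ₛ g) *ₛ h ≈ₛ f *ₛ (g *ₛ h)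
  *ₛ-assoc f g h zero    = *-assoc (f 0) (g 0) (h 0)
  *ₛ-assoc f g h (suc n) = begin
    ((f *ₛ g) *ₛ h) (suc n)
      ≈⟨ *ₛ-head n (f *ₛ g) h ⟩
    (f 0 * g 0) * h (suc n) + ((λ i → (f *ₛ g) (suc i)) *ₛ h) n
      ≈⟨ +-cong (*-assoc _ _ _) (*ₛ-cong {g = h} (λ i → *ₛ-head i f g) (λ _ → refl) n) ⟩
    f 0 * (g 0 * h (suc n)) + (((λ i → f 0 * g (suc i)) +ₛ f′ *ₛ g) *ₛ h) n
      ≈⟨ +-congˡ (*ₛ-distribʳ h _ (f′ *ₛ g) n) ⟩
    f 0 * (g 0 * h (suc n)) + (((λ i → f 0 * g (suc i)) *ₛ h) n + ((f′ *ₛ g) *ₛ h) n)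
      ≈⟨ +-congˡ (+-cong (*ₛ-scaleˡ (f 0) g′ h n) (*ₛ-assoc f′ g h n)) ⟩
    f 0 * (g 0 * h (suc n)) + (f 0 * (g′ *ₛ h) n + (f′ *ₛ (g *ₛ h)) n)
      ≈⟨ +-assoc _ _ _ ⟨
    (f 0 * (g 0 * h (suc n)) + f 0 * (g′ *ₛ h) n) + (f′ *ₛ (g *ₛ h)) n
      ≈⟨ +-congʳ (trans (*-congˡ (*ₛ-head n g h)) (distribˡ _ _ _)) ⟨
    f 0 * (g *ₛ h) (suc n) + (f′ *ₛ (g *ₛ h)) n
      ≈⟨ *ₛ-head n f (g *ₛ h) ⟨
    (f *ₛ (g *ₛ h)) (suc n) ∎
    where
    f′ g′ : Series
    f′ i = f (suc i)
    g′ i = g (suc i)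

  *ₛ-identityˡ : ∀ f → 1ₛ *ₛ f ≈ₛ f
  *ₛ-identityˡ f n = trans (const-*ₛ 1# f n) (*-identityˡ (f n))

  powerSeriesRing : CommutativeRing c ℓ
  powerSeriesRing = record
    { Carrier = Series
    ; _≈_ = _≈ₛ_
    ; _+_ = _+ₛ_
    ; _*_ = _*ₛ_
    ; -_ = -ₛ_
    ; 0# = 0ₛ
    ; 1# = 1ₛ
    ; isCommutativeRing = record
      { isRing = record
        { +-isAbelianGroup = Pointwise.isAbelianGroup ℕ +-isAbelianGroup
        ; *-cong = *ₛ-cong
        ; *-assoc = *ₛ-assoc
        ; *-identity = *ₛ-identityˡ , λ f n → trans (*ₛ-comm f 1ₛ n) (*ₛ-identityˡ f n)
        ; distrib = *ₛ-distribˡ , λ h f g → *ₛ-distribʳ h f g }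
      ; *-comm = *ₛ-comm } }

  *X-suc : ∀ f n → (f *ₛ X) (suc n) ≈ f n
  *X-suc f n = begin
    (f *ₛ X) (suc n)                   ≈⟨ *ₛ-last n f X ⟩
    (f *ₛ 1ₛ′) n + f (suc n) * 0#      ≈⟨ +-cong (*ₛ-comm f 1ₛ′ n) (zeroʳ _) ⟩
    (1ₛ′ *ₛ f) n + 0#                  ≈⟨ +-identityʳ _ ⟩
    (1ₛ′ *ₛ f) n                       ≈⟨ *ₛ-cong {g = f} 1ₛ′≈1ₛ (λ _ → refl) n ⟩
    (1ₛ *ₛ f) n                        ≈⟨ *ₛ-identityˡ f n ⟩
    f n                                ∎
    where
    1ₛ′ : Series
    1ₛ′ i = X (suc i)
    1ₛ′≈1ₛ : 1ₛ′ ≈ₛ 1ₛ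
    1ₛ′≈1ₛ zero    = refl
    1ₛ′≈1ₛ (suc _) = refl

  *X-shift : ∀ f g → g 0 ≈ 0# → (∀ n → g (suc n) ≈ f n) → g ≈ₛ f *ₛ X
  *X-shift f g g₀≈0 _ zero    = trans g₀≈0 (sym (zeroʳ (f 0)))
  *X-shift f g _ gₛ≈f (suc n) = trans (gₛ≈f n) (sym (*X-suc f n))

  *ₛ-const : ∀ f x → f *ₛ const x ≈ₛ (λ n → f n * x)
  *ₛ-const f x n = trans (*ₛ-comm f (const x) n) (trans (const-*ₛ x f n) (*-comm x (f n)))

  const-cong : ∀ {x y} → x ≈ y → const x ≈ₛ const y
  const-cong x≈y zero    = x≈y
  const-cong x≈y (suc _) = refl

  const-* : ∀ x y → const (x * y) ≈ₛ const x *ₛ const y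
  const-* x y zero    = refl
  const-* x y (suc n) = sym (trans (const-*ₛ x (const y) (suc n)) (zeroʳ x))

open import Defs

module TrivariateSeries where

  open import Data.Nat using (_∸_)
  open import Data.Integer using (ℤ) renaming (_+_ to _+ℤ_; _*_ to _*ℤ_; -_ to -ℤ_; _≟_ to _≟ℤ_)
  open import Data.Integer.Properties using (+-*-commutativeRing)
  open import Data.Maybe using (just; nothing)
  open import Relation.Nullary using (yes; no)
  open import Relation.Binary.Definitions using (WeaklyDecidable)
  open import Relation.Binary.PropositionalEquality using (_≡_; refl; sym; trans; cong; cong₂; module ≡-Reasoning)
  open import Algebra.Solver.Ring.AlmostCommutativeRing
    using (fromCommutativeRing; _-Raw-AlmostCommutative⟶_; Induced-equivalence)

  private
    module S₁ = PowerSeries +-*-commutativeRing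
    module S₂ = PowerSeries S₁.powerSeriesRing
    module S₃ = PowerSeries S₂.powerSeriesRing
    module R₁ = CommutativeRing S₁.powerSeriesRing
    module R₂ = CommutativeRing S₂.powerSeriesRing

  -- The coefficient of xⁿ yᵏ zˡ in f is f n k l, so the carrier is Defs.PS.
  ℤ⟦x,y,z⟧ : CommutativeRing _ _
  ℤ⟦x,y,z⟧ = S₃.powerSeriesRing

  open CommutativeRing ℤ⟦x,y,z⟧ public
    using (_+_; _*_; -_; _-_; 0#; 1#; zeroʳ; +-identityʳ; -‿inverseʳ; +-cong; +-congˡ; +-congʳ; *-cong; *-congˡ; *-congʳ; -‿cong; setoid)
    renaming (refl to ≈-refl; trans to ≈-trans)

  sumTo≡sumUpTo : ∀ n f → sumTo n f ≡ sumUpTo _+ℤ_ n f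
  sumTo≡sumUpTo zero    f = refl
  sumTo≡sumUpTo (suc n) f = cong (_+ℤ f (suc n)) (sumTo≡sumUpTo n f)

  sumUpTo-apply : ∀ {A B : Set} (_⊕_ : B → B → B) n (F : ℕ → A → B) (a : A) →
    sumUpTo (λ f g x → f x ⊕ g x) n F a ≡ sumUpTo _⊕_ n (λ i → F i a)
  sumUpTo-apply _⊕_ zero    F a = refl
  sumUpTo-apply _⊕_ (suc n) F a = cong (_⊕ F (suc n) a) (sumUpTo-apply _⊕_ n F a)

  ⊛≈* : ∀ f g → f ⊛ g ≈ f * g
  ⊛≈* f g n k l = sym (begin
    (f * g) n k l
      ≡⟨ cong (λ h → h l) (sumUpTo-apply _ n (λ i → f i S₂.*ₛ g (n ∸ i)) k) ⟩
    sumUpTo S₁._+ₛ_ n (λ i → (f i S₂.*ₛ g (n ∸ i)) k) l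
      ≡⟨ sumUpTo-apply _ n (λ i → (f i S₂.*ₛ g (n ∸ i)) k) l ⟩
    sumUpTo _+ℤ_ n (λ i → (f i S₂.*ₛ g (n ∸ i)) k l)
      ≡⟨ sumUpTo-cong n (λ i → trans (sumUpTo-apply _ k (λ j → f i j S₁.*ₛ g (n ∸ i) (k ∸ j)) l)
                                      (sumUpTo-cong k (λ j → sym (sumTo≡sumUpTo l _)))) ⟩
    sumUpTo _+ℤ_ n (λ i → sumUpTo _+ℤ_ k (λ j → sumTo l (λ m → f i j m *ℤ g (n ∸ i) (k ∸ j) (l ∸ m))))
      ≡⟨ sym (trans (sumTo≡sumUpTo n _) (sumUpTo-cong n (λ i → sumTo≡sumUpTo k _))) ⟩
    (f ⊛ g) n k l ∎)
    where
    open ≡-Reasoning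
    sumUpTo-cong : ∀ n {f g : ℕ → ℤ} → (∀ i → f i ≡ g i) → sumUpTo _+ℤ_ n f ≡ sumUpTo _+ℤ_ n g
    sumUpTo-cong zero    f≡g = f≡g 0
    sumUpTo-cong (suc n) f≡g = cong₂ _+ℤ_ (sumUpTo-cong n f≡g) (f≡g (suc n))

  κ : ℤ → PS
  κ c = S₃.const (S₂.const (S₁.const c))

  x y z : PS
  x = S₃.X
  y = S₃.const S₂.X
  z = S₃.const (S₂.const S₁.X)

  private
    κ-+ : ∀ a b → κ (a +ℤ b) ≈ κ a + κ b
    κ-+ a b zero    zero    zero    = refl
    κ-+ a b zero    zero    (suc l) = refl
    κ-+ a b zero    (suc k) l       = refl
    κ-+ a b (suc n) k       l       = refl

    κ-* : ∀ a b → κ (a *ℤ b) ≈ κ a * κ b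
    κ-* a b = ≈-trans (S₃.const-cong (S₂.const-cong (S₁.const-* a b)))
                      (≈-trans (S₃.const-cong (S₂.const-* _ _)) (S₃.const-* _ _))

    κ-neg : ∀ a → κ (-ℤ a) ≈ - κ a
    κ-neg a zero    zero    zero    = refl
    κ-neg a zero    zero    (suc l) = refl
    κ-neg a zero    (suc k) l       = refl
    κ-neg a (suc n) k       l       = refl

    κ-0 : κ (+ 0) ≈ 0#
    κ-0 zero    zero    zero    = refl
    κ-0 zero    zero    (suc l) = refl
    κ-0 zero    (suc k) l       = refl
    κ-0 (suc n) k       l       = refl

    κ-1 : κ (+ 1) ≈ 1#
    κ-1 zero    zero    zero    = refl
    κ-1 zero    zero    (suc l) = refl
    κ-1 zero    (suc k) l       = refl
    κ-1 (suc n) k       l       = refl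

    κ-morphism : CommutativeRing.rawRing +-*-commutativeRing -Raw-AlmostCommutative⟶ fromCommutativeRing ℤ⟦x,y,z⟧
    κ-morphism = record
      { ⟦_⟧ = κ ; +-homo = κ-+ ; *-homo = κ-* ; -‿homo = κ-neg ; 0-homo = κ-0 ; 1-homo = κ-1 }

    _coeff≟_ : WeaklyDecidable (Induced-equivalence κ-morphism)
    a coeff≟ b with a ≟ℤ b
    ... | yes refl = just ≈-refl
    ... | no _     = nothing

  open import Algebra.Solver.Ring (CommutativeRing.rawRing +-*-commutativeRing)
    (fromCommutativeRing ℤ⟦x,y,z⟧) κ-morphism _coeff≟_ public

  open import Algebra.Properties.Semiring.Exp (CommutativeRing.semiring ℤ⟦x,y,z⟧) public using (_^_)

  private
    mon-x : ∀ c a b d → mon c (suc a) b d ≈ mon c a b d * x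
    mon-x c a b d = S₃.*X-shift (mon c a b d) (mon c (suc a) b d) (λ _ _ → refl) (λ _ _ _ → refl)

    mon-y : ∀ c b d → mon c 0 (suc b) d ≈ mon c 0 b d * y
    mon-y c b d n = R₂.trans (shifted n) (R₂.sym (S₃.*ₛ-const (mon c 0 b d) S₂.X n))
      where
      shifted : ∀ n → mon c 0 (suc b) d n R₂.≈ mon c 0 b d n S₂.*ₛ S₂.X
      shifted zero    = S₂.*X-shift (mon c 0 b d 0) (mon c 0 (suc b) d 0) (λ _ → refl) (λ _ _ → refl)
      shifted (suc n) = R₂.sym (R₂.zeroˡ S₂.X)

    mon-z : ∀ c d → mon c 0 0 (suc d) ≈ mon c 0 0 d * z
    mon-z c d n k l = trans (shifted n k l)
      (sym (trans (S₃.*ₛ-const (mon c 0 0 d) (S₂.const S₁.X) n k l) (S₂.*ₛ-const (mon c 0 0 d n) S₁.X k l)))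
      where
      shifted : ∀ n k → mon c 0 0 (suc d) n k S₁.≈ₛ mon c 0 0 d n k S₁.*ₛ S₁.X
      shifted zero    zero    = S₁.*X-shift (mon c 0 0 d 0 0) (mon c 0 0 (suc d) 0 0) refl (λ _ → refl)
      shifted zero    (suc k) = R₁.sym (R₁.zeroˡ S₁.X)
      shifted (suc n) k       = R₁.sym (R₁.zeroˡ S₁.X)

    mon-const : ∀ c → mon c 0 0 0 ≈ κ c
    mon-const c zero    zero    zero    = refl
    mon-const c zero    zero    (suc l) = refl
    mon-const c zero    (suc k) l       = refl
    mon-const c (suc n) k       l       = refl

  mon≈ : ∀ c a b d → mon c a b d ≈ κ c * x ^ a * y ^ b * z ^ d
  mon≈ c zero zero zero = ≈-trans (mon-const c)
    (solve 1 (λ k → k := k :* con (+ 1) :* con (+ 1) :* con (+ 1)) ≈-refl (κ c))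
  mon≈ c zero zero (suc d) = ≈-trans (mon-z c d) (≈-trans (*-congʳ {z} (mon≈ c 0 0 d))
    (solve 3 (λ k z zᵈ → k :* con (+ 1) :* con (+ 1) :* zᵈ :* z := k :* con (+ 1) :* con (+ 1) :* (z :* zᵈ))
           ≈-refl (κ c) z (z ^ d)))
  mon≈ c zero (suc b) d = ≈-trans (mon-y c b d) (≈-trans (*-congʳ {y} (mon≈ c 0 b d))
    (solve 4 (λ k y yᵇ zᵈ → k :* con (+ 1) :* yᵇ :* zᵈ :* y := k :* con (+ 1) :* (y :* yᵇ) :* zᵈ)
           ≈-refl (κ c) y (y ^ b) (z ^ d)))
  mon≈ c (suc a) b d = ≈-trans (mon-x c a b d) (≈-trans (*-congʳ {x} (mon≈ c a b d))
    (solve 5 (λ k x xᵃ yᵇ zᵈ → k :* xᵃ :* yᵇ :* zᵈ :* x := k :* (x :* xᵃ) :* yᵇ :* zᵈ)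
           ≈-refl (κ c) x (x ^ a) (y ^ b) (z ^ d)))

  infixl 6 _⟨+⟩_ _⟨-⟩_
  _⟨+⟩_ : ∀ {f f′ g g′} → f ≈ f′ → g ≈ g′ → f + g ≈ f′ + g′
  _⟨+⟩_ = +-cong
  _⟨-⟩_ : ∀ {f f′ g g′} → f ≈ f′ → g ≈ g′ → f - g ≈ f′ - g′
  f≈f′ ⟨-⟩ g≈g′ = +-cong f≈f′ (-‿cong g≈g′)

  monₚ : ∀ {n} → ℤ → ℕ → ℕ → ℕ → Polynomial n → Polynomial n → Polynomial n → Polynomial n
  monₚ c a b d x y z = con c :* x :^ a :* y :^ b :* z :^ d

module Solution where
  open import Relation.Binary.PropositionalEquality using (refl)
  open TrivariateSeries
  open import Relation.Binary.Reasoning.Setoid setoid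

  two four : PS
  two  = κ (+ 2)
  four = κ (+ 4)

  lead mid low : PS → PS → PS → PS
  lead u w t = u * (1# + u * t - u * w)
  mid  u w t = u + u * w - two * u * u * w + two * u * u * t - 1#
  low  u w t = u * (w - u * w + u * t)

  leadₚ midₚ lowₚ : ∀ {n} → Polynomial n → Polynomial n → Polynomial n → Polynomial n
  leadₚ u w t = u :* (con (+ 1) :+ u :* t :- u :* w)
  midₚ  u w t = u :+ u :* w :- con (+ 2) :* u :* u :* w :+ con (+ 2) :* u :* u :* t :- con (+ 1)
  lowₚ  u w t = u :* (w :- u :* w :+ u :* t)

  vanishes : ∀ p {f g} → f ≈ g → p * (f - g) ≈ 0#
  vanishes p {f} {g} f≈g = ≈-trans (*-congˡ {p} (≈-trans (+-congʳ { - g} f≈g) (-‿inverseʳ g))) (zeroʳ p)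

  -- The left side is an explicit combination of the four equations, found by eliminating E, C, G.
  root-of-system : ∀ u w t A E C G →
    A ≈ u * E * (1# + A) → E ≈ w + C → C ≈ u * G → G ≈ t + C + E * C →
    lead u w t * A * A + mid u w t * A + low u w t ≈ 0#
  root-of-system u w t A E C G hA hE hC hG = begin
    lead u w t * A * A + mid u w t * A + low u w t
      ≈⟨ certificate u w t A E C G ⟩
    p₁ * (A - u * E * (1# + A)) + p₂ * (E - (w + C)) + p₃ * (C - u * G) + p₄ * (G - (t + C + E * C))
      ≈⟨ vanishes p₁ hA ⟨+⟩ vanishes p₂ hE ⟨+⟩ vanishes p₃ hC ⟨+⟩ vanishes p₄ hG ⟩
    0# + 0# + 0# + 0#
      ≈⟨ (λ _ _ _ → refl) ⟩
    0# ∎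
    where
    p₁ p₂ p₃ p₄ : PS
    p₁ = u * (1# + C) * (1# + A) - 1#
    p₂ = u * (1# + A) * (u * (1# + A) - 1#)
    p₃ = - (u * (1# + A) * (1# + A))
    p₄ = - (u * u * (1# + A) * (1# + A))
    certificate : ∀ u w t A E C G →
      lead u w t * A * A + mid u w t * A + low u w t ≈
      (u * (1# + C) * (1# + A) - 1#) * (A - u * E * (1# + A))
      + u * (1# + A) * (u * (1# + A) - 1#) * (E - (w + C))
      + - (u * (1# + A) * (1# + A)) * (C - u * G)
      + - (u * u * (1# + A) * (1# + A)) * (G - (t + C + E * C))
    certificate = solve 7 (λ u w t A E C G →
      let 𝟙 = con (+ 1) in
      leadₚ u w t :* A :* A :+ midₚ u w t :* A :+ lowₚ u w t
      := (u :* (𝟙 :+ C) :* (𝟙 :+ A) :- 𝟙) :* (A :- u :* E :* (𝟙 :+ A))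
        :+ u :* (𝟙 :+ A) :* (u :* (𝟙 :+ A) :- 𝟙) :* (E :- (w :+ C))
        :+ :- (u :* (𝟙 :+ A) :* (𝟙 :+ A)) :* (C :- u :* G)
        :+ :- (u :* u :* (𝟙 :+ A) :* (𝟙 :+ A)) :* (G :- (t :+ C :+ E :* C))) ≈-refl

  completing-square : ∀ a b c A → a * A * A + b * A + c ≈ 0# →
    (- b - two * a * A) * (- b - two * a * A) ≈ b * b - four * a * c
  completing-square a b c A root = begin
    (- b - two * a * A) * (- b - two * a * A)
      ≈⟨ solve 4 (λ a b c A → (:- b :- con (+ 2) :* a :* A) :* (:- b :- con (+ 2) :* a :* A)
                  := b :* b :- con (+ 4) :* a :* c :+ con (+ 4) :* a :* (a :* A :* A :+ b :* A :+ c))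
                 ≈-refl a b c A ⟩
    b * b - four * a * c + four * a * (a * A * A + b * A + c)
      ≈⟨ +-congˡ {b * b - four * a * c} (*-congˡ {four * a} root) ⟩
    b * b - four * a * c + four * a * 0#
      ≈⟨ +-congˡ {b * b - four * a * c} (zeroʳ (four * a)) ⟩
    b * b - four * a * c + 0#
      ≈⟨ +-identityʳ _ ⟩
    b * b - four * a * c ∎

  private
    u w : PS
    u = x * y
    w = x * z

  Pnum≈ : Pnum ≈ - mid u w x
  Pnum≈ = ≈-trans (mon≈ (+ 1) 0 0 0 ⟨-⟩ mon≈ (+ 1) 1 1 0 ⟨-⟩ mon≈ (+ 1) 2 1 1 ⟨-⟩ mon≈ (+ 2) 3 2 0 ⟨+⟩ mon≈ (+ 2) 3 2 1)
    (solve 3 (λ x y z →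
       monₚ (+ 1) 0 0 0 x y z :- monₚ (+ 1) 1 1 0 x y z :- monₚ (+ 1) 2 1 1 x y z
         :- monₚ (+ 2) 3 2 0 x y z :+ monₚ (+ 2) 3 2 1 x y z
       := :- midₚ (x :* y) (x :* z) x) ≈-refl x y z)

  Den≈ : Den ≈ two * lead u w x
  Den≈ = ≈-trans (mon≈ (+ 2) 1 1 0 ⟨+⟩ mon≈ (+ 2) 3 2 0 ⟨-⟩ mon≈ (+ 2) 3 2 1)
    (solve 3 (λ x y z →
       monₚ (+ 2) 1 1 0 x y z :+ monₚ (+ 2) 3 2 0 x y z :- monₚ (+ 2) 3 2 1 x y z
       := con (+ 2) :* leadₚ (x :* y) (x :* z) x) ≈-refl x y z)

  Rpoly≈ : Rpoly ≈ mid u w x * mid u w x - four * lead u w x * low u w x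
  Rpoly≈ = ≈-trans (mon≈ (+ 1) 4 2 2 ⟨+⟩ mon≈ (+ 2) 3 2 1 ⟨-⟩ mon≈ (+ 4) 3 2 0 ⟨+⟩ mon≈ (+ 1) 2 2 0
                    ⟨-⟩ mon≈ (+ 2) 2 1 1 ⟨-⟩ mon≈ (+ 2) 1 1 0 ⟨+⟩ mon≈ (+ 1) 0 0 0)
    (solve 3 (λ x y z →
       monₚ (+ 1) 4 2 2 x y z :+ monₚ (+ 2) 3 2 1 x y z :- monₚ (+ 4) 3 2 0 x y z :+ monₚ (+ 1) 2 2 0 x y z
         :- monₚ (+ 2) 2 1 1 x y z :- monₚ (+ 2) 1 1 0 x y z :+ monₚ (+ 1) 0 0 0 x y z
       := midₚ (x :* y) (x :* z) x :* midₚ (x :* y) (x :* z) x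
          :- con (+ 4) :* leadₚ (x :* y) (x :* z) x :* lowₚ (x :* y) (x :* z) x) ≈-refl x y z)

  sqrt-from-system : ∀ {A E C G} →
    A ≈ x * y * E * (1# + A) → E ≈ x * z + C → C ≈ x * y * G → G ≈ x + C + E * C →
    IsSqrtOf (Pnum ⊖ Den ⊛ A) Rpoly
  sqrt-from-system {A} {E} {C} {G} hA hE hC hG = square , refl   -- Den has no constant term
    where
    S : PS
    S = Pnum ⊖ Den ⊛ A
    S≈ : S ≈ - mid u w x - two * lead u w x * A
    S≈ = Pnum≈ ⟨-⟩ ≈-trans (⊛≈* Den A) (*-congʳ {A} Den≈)
    square : S ⊛ S ≈ Rpoly
    square = begin
      S ⊛ S                                                             ≈⟨ ⊛≈* S S ⟩
      S * S                                                             ≈⟨ *-cong S≈ S≈ ⟩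
      (- mid u w x - two * lead u w x * A) * (- mid u w x - two * lead u w x * A)
        ≈⟨ completing-square (lead u w x) (mid u w x) (low u w x) A (root-of-system u w x A E C G hA hE hC hG) ⟩
      mid u w x * mid u w x - four * lead u w x * low u w x             ≈⟨ Rpoly≈ ⟨
      Rpoly                                                             ∎

module FirstPassages where

  open import Data.Nat using (_+_; _∸_; _≤ᵇ_)
  open import Data.Bool using (Bool; true; false; T; _∧_)
  open import Data.List using (List; []; _∷_; _++_; length; null)
  open import Data.List.Properties using (∷-injectiveˡ; ∷-injectiveʳ; ++-identityʳ; ++-conicalʳ)
  open import Data.Product using (∃₂)
  open import Data.Unit using (tt)
  open import Data.Empty using (⊥-elim)
  open import Relation.Binary.PropositionalEquality using (_≡_; _≢_; refl; sym; trans; cong; cong₂; subst)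

  -- firstHit p h w: w, started at height h right after a down-step if p, stays above the x-axis
  -- and reaches it exactly with its last step.  firstHitDown h j w is the same for D_{j+1} ∷ w.
  mutual
    firstHit : Bool → ℕ → List Step → Bool
    firstHit p     h []           = false
    firstHit p     h (up ∷ w)     = firstHit false (suc h) w
    firstHit true  h (down j ∷ w) = false
    firstHit false h (down j ∷ w) = firstHitDown h j w

    firstHitDown : ℕ → ℕ → List Step → Bool
    firstHitDown zero          j       w = false
    firstHitDown (suc h)       (suc j) w = firstHitDown h j w
    firstHitDown (suc zero)    zero    w = null w
    firstHitDown (suc (suc h)) zero    w = firstHit true (suc h) w

  mutual
    firstHit-++ : ∀ p h v r → T (firstHit p h v) → T (walk true 0 r) → T (walk p h (v ++ r))
    firstHit-++ p     h (up ∷ v)     r hv hr = firstHit-++ false (suc h) v r hv hr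
    firstHit-++ false h (down j ∷ v) r hv hr = firstHitDown-++ h j v r hv hr

    firstHitDown-++ : ∀ h j v r → T (firstHitDown h j v) → T (walk true 0 r) →
                      T ((suc j ≤ᵇ h) ∧ walk true (h ∸ suc j) (v ++ r))
    firstHitDown-++ (suc zero)    zero    [] r hv hr = hr
    firstHitDown-++ (suc (suc h)) zero    v  r hv hr = firstHit-++ true (suc h) v r hv hr
    firstHitDown-++ (suc h)       (suc j) v  r hv hr = firstHitDown-++ h j v r hv hr

  mutual
    walk-split : ∀ p h w → T (walk p (suc h) w) →
                 ∃₂ λ v r → w ≡ v ++ r × T (firstHit p (suc h) v) × T (walk true 0 r)
    walk-split p     h (up ∷ w)     hw with walk-split false (suc h) w hw
    ... | v , r , refl , hv , hr = up ∷ v , r , refl , hv , hr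
    walk-split false h (down j ∷ w) hw with walkDown-split (suc h) j w hw
    ... | v , r , refl , hv , hr = down j ∷ v , r , refl , hv , hr

    walkDown-split : ∀ h j w → T ((suc j ≤ᵇ h) ∧ walk true (h ∸ suc j) w) →
                     ∃₂ λ v r → w ≡ v ++ r × T (firstHitDown h j v) × T (walk true 0 r)
    walkDown-split (suc zero)    zero    w hw = [] , w , refl , tt , hw
    walkDown-split (suc (suc h)) zero    w hw = walk-split true h w hw
    walkDown-split (suc h)       (suc j) w hw = walkDown-split h j w hw

  mutual
    firstHit-prefix-unique : ∀ p h v v′ r r′ → T (firstHit p h v) → T (firstHit p h v′) →
                             v ++ r ≡ v′ ++ r′ → v ≡ v′
    firstHit-prefix-unique p h (up ∷ v) (up ∷ v′) r r′ hv hv′ eq =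
      cong (up ∷_) (firstHit-prefix-unique false (suc h) v v′ r r′ hv hv′ (∷-injectiveʳ eq))
    firstHit-prefix-unique false h (down j ∷ v) (down j′ ∷ v′) r r′ hv hv′ eq with ∷-injectiveˡ eq
    ... | refl = cong (down j ∷_) (firstHitDown-prefix-unique h j v v′ r r′ hv hv′ (∷-injectiveʳ eq))
    firstHit-prefix-unique p h (up ∷ v) (down j ∷ v′) r r′ hv hv′ ()
    firstHit-prefix-unique p h (down j ∷ v) (up ∷ v′) r r′ hv hv′ ()

    firstHitDown-prefix-unique : ∀ h j v v′ r r′ → T (firstHitDown h j v) → T (firstHitDown h j v′) →
                                 v ++ r ≡ v′ ++ r′ → v ≡ v′
    firstHitDown-prefix-unique (suc zero)    zero    [] []  r r′ hv hv′ eq = refl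
    firstHitDown-prefix-unique (suc (suc h)) zero    v  v′ r r′ hv hv′ eq =
      firstHit-prefix-unique true (suc h) v v′ r r′ hv hv′ eq
    firstHitDown-prefix-unique (suc h)       (suc j) v  v′ r r′ hv hv′ eq =
      firstHitDown-prefix-unique h j v v′ r r′ hv hv′ eq

  lengthen : Step → Step
  lengthen up       = up
  lengthen (down j) = down (suc j)

  lengthenLast : List Step → List Step
  lengthenLast []          = []
  lengthenLast (s ∷ [])    = lengthen s ∷ []
  lengthenLast (s ∷ t ∷ w) = s ∷ lengthenLast (t ∷ w)

  lengthenLast-up : ∀ v → lengthenLast (up ∷ v) ≡ up ∷ lengthenLast v
  lengthenLast-up []      = refl
  lengthenLast-up (_ ∷ _) = refl

  lengthenLast-≢[] : ∀ t w → lengthenLast (t ∷ w) ≢ []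
  lengthenLast-≢[] t []      ()
  lengthenLast-≢[] t (_ ∷ _) ()

  lengthen-injective : ∀ {s s′} → lengthen s ≡ lengthen s′ → s ≡ s′
  lengthen-injective {up}     {up}     _    = refl
  lengthen-injective {down _} {down _} refl = refl

  lengthenLast-injective : ∀ v v′ → lengthenLast v ≡ lengthenLast v′ → v ≡ v′
  lengthenLast-injective []          []            _  = refl
  lengthenLast-injective []          (t ∷ w)       eq = ⊥-elim (lengthenLast-≢[] t w (sym eq))
  lengthenLast-injective (t ∷ w)     []            eq = ⊥-elim (lengthenLast-≢[] t w eq)
  lengthenLast-injective (s ∷ [])    (s′ ∷ [])     eq = cong (_∷ []) (lengthen-injective (∷-injectiveˡ eq))
  lengthenLast-injective (s ∷ [])    (s′ ∷ t ∷ w)  eq = ⊥-elim (lengthenLast-≢[] t w (sym (∷-injectiveʳ eq)))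
  lengthenLast-injective (s ∷ t ∷ w) (s′ ∷ [])     eq = ⊥-elim (lengthenLast-≢[] t w (∷-injectiveʳ eq))
  lengthenLast-injective (s ∷ t ∷ w) (s′ ∷ t′ ∷ w′) eq =
    cong₂ _∷_ (∷-injectiveˡ eq) (lengthenLast-injective (t ∷ w) (t′ ∷ w′) (∷-injectiveʳ eq))

  mutual
    firstHit-lengthenLast : ∀ p h v → T (firstHit p h v) → T (firstHit p (suc h) (lengthenLast v))
    firstHit-lengthenLast p h (up ∷ v) hv =
      subst (T ∘ firstHit p (suc h)) (sym (lengthenLast-up v)) (firstHit-lengthenLast false (suc h) v hv)
    firstHit-lengthenLast false h (down j ∷ [])        hv = hv
    firstHit-lengthenLast false h (down j ∷ v@(_ ∷ _)) hv = firstHitDown-lengthenLast h j v hv (λ ())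

    firstHitDown-lengthenLast : ∀ h j v → T (firstHitDown h j v) → v ≢ [] →
                                T (firstHitDown (suc h) j (lengthenLast v))
    firstHitDown-lengthenLast (suc h)       (suc j) v        hv v≢[] = firstHitDown-lengthenLast h j v hv v≢[]
    firstHitDown-lengthenLast (suc (suc h)) zero    v        hv _    = firstHit-lengthenLast true (suc h) v hv
    firstHitDown-lengthenLast (suc zero)    zero    []       _  v≢[] = ⊥-elim (v≢[] refl)

  mutual
    firstHit-raise-++ : ∀ p h v w → T (firstHit p h v) → T (firstHit true 1 w) → T (firstHit p (suc h) (v ++ w))
    firstHit-raise-++ p     h (up ∷ v)     w hv hw = firstHit-raise-++ false (suc h) v w hv hw
    firstHit-raise-++ false h (down j ∷ v) w hv hw = firstHitDown-raise-++ h j v w hv hw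

    firstHitDown-raise-++ : ∀ h j v w → T (firstHitDown h j v) → T (firstHit true 1 w) →
                            T (firstHitDown (suc h) j (v ++ w))
    firstHitDown-raise-++ (suc h)       (suc j) v  w hv hw = firstHitDown-raise-++ h j v w hv hw
    firstHitDown-raise-++ (suc zero)    zero    [] w hv hw = hw
    firstHitDown-raise-++ (suc (suc h)) zero    v  w hv hw = firstHit-raise-++ true (suc h) v w hv hw

  -- A first passage from height h + 2 either jumps over height h + 1 with its last step, or it
  -- first touches height h + 1 and continues with a first passage from there.
  data RaisedFirstHit (p : Bool) (h : ℕ) (w : List Step) : Set where
    jumps   : ∀ v → w ≡ lengthenLast v → T (firstHit p (suc h) v) → RaisedFirstHit p h w
    touches : ∀ v w′ → w ≡ v ++ w′ → T (firstHit p (suc h) v) → T (firstHit true 1 w′) → RaisedFirstHit p h w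

  data RaisedFirstHitDown (h j : ℕ) (w : List Step) : Set where
    jumps   : ∀ t u → w ≡ lengthenLast (t ∷ u) → T (firstHitDown (suc h) j (t ∷ u)) → RaisedFirstHitDown h j w
    lands   : w ≡ [] → j ≡ suc h → RaisedFirstHitDown h j w
    touches : ∀ v w′ → w ≡ v ++ w′ → T (firstHitDown (suc h) j v) → T (firstHit true 1 w′) →
              RaisedFirstHitDown h j w

  firstHitDown-exact : ∀ h → T (firstHitDown (suc h) h [])
  firstHitDown-exact zero    = tt
  firstHitDown-exact (suc h) = firstHitDown-exact h

  mutual
    raisedFirstHit : ∀ p h w → T (firstHit p (suc (suc h)) w) → RaisedFirstHit p h w
    raisedFirstHit p h (up ∷ w) hw with raisedFirstHit false (suc h) w hw
    ... | jumps v refl hv = jumps (up ∷ v) (sym (lengthenLast-up v)) hv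
    ... | touches v w′ refl hv hw′ = touches (up ∷ v) w′ refl hv hw′
    raisedFirstHit false h (down j ∷ w) hw with raisedFirstHitDown h j w hw
    ... | jumps t u refl hv = jumps (down j ∷ t ∷ u) refl hv
    ... | lands refl refl = jumps (down h ∷ []) refl (firstHitDown-exact h)
    ... | touches v w′ refl hv hw′ = touches (down j ∷ v) w′ refl hv hw′

    raisedFirstHitDown : ∀ h j w → T (firstHitDown (suc (suc h)) j w) → RaisedFirstHitDown h j w
    raisedFirstHitDown zero    (suc zero) [] hw = lands refl refl
    raisedFirstHitDown (suc h) (suc j)    w  hw with raisedFirstHitDown h j w hw
    ... | jumps t u eq hv = jumps t u eq hv
    ... | lands eq refl = lands eq refl
    ... | touches v w′ eq hv hw′ = touches v w′ eq hv hw′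
    raisedFirstHitDown zero    zero       w  hw = touches [] w refl tt hw
    raisedFirstHitDown (suc h) zero       w  hw with raisedFirstHit true h w hw
    ... | jumps (t ∷ u) eq hv = jumps t u eq hv
    ... | touches v w′ eq hv hw′ = touches v w′ eq hv hw′

  mutual
    lengthenLast-≢-++ : ∀ p h v v′ w → T (firstHit p h v) → T (firstHit p h v′) → T (firstHit true 1 w) →
                        lengthenLast v ≢ v′ ++ w
    lengthenLast-≢-++ p h (s ∷ []) (s′ ∷ v′) w hv hv′ hw eq with ++-conicalʳ v′ w (sym (∷-injectiveʳ eq))
    ... | refl = hw
    lengthenLast-≢-++ p h (s ∷ v@(_ ∷ _)) (s′ ∷ v′) w hv hv′ hw eq with ∷-injectiveˡ eq
    lengthenLast-≢-++ p     h (up ∷ v@(_ ∷ _))     (up ∷ v′)     w hv hv′ hw eq | refl =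
      lengthenLast-≢-++ false (suc h) v v′ w hv hv′ hw (∷-injectiveʳ eq)
    lengthenLast-≢-++ false h (down j ∷ v@(_ ∷ _)) (down j ∷ v′) w hv hv′ hw eq | refl =
      lengthenLast-≢-++Down h j v v′ w hv hv′ hw (λ ()) (∷-injectiveʳ eq)

    lengthenLast-≢-++Down : ∀ h j v v′ w → T (firstHitDown h j v) → T (firstHitDown h j v′) →
                            T (firstHit true 1 w) → v ≢ [] → lengthenLast v ≢ v′ ++ w
    lengthenLast-≢-++Down (suc h)       (suc j) v  v′ w hv hv′ hw v≢[] = lengthenLast-≢-++Down h j v v′ w hv hv′ hw v≢[]
    lengthenLast-≢-++Down (suc (suc h)) zero    v  v′ w hv hv′ hw _    = lengthenLast-≢-++ true (suc h) v v′ w hv hv′ hw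
    lengthenLast-≢-++Down (suc zero)    zero    [] v′ w hv hv′ hw v≢[] = ⊥-elim (v≢[] refl)

  countU-++ : ∀ v w → countU (v ++ w) ≡ countU v + countU w
  countU-++ []           w = refl
  countU-++ (up ∷ v)     w = cong suc (countU-++ v w)
  countU-++ (down _ ∷ v) w = countU-++ v w

  countD1-++ : ∀ v w → countD1 (v ++ w) ≡ countD1 v + countD1 w
  countD1-++ []                 w = refl
  countD1-++ (up ∷ v)           w = countD1-++ v w
  countD1-++ (down zero ∷ v)    w = cong suc (countD1-++ v w)
  countD1-++ (down (suc _) ∷ v) w = countD1-++ v w

  length-lengthenLast : ∀ v → length (lengthenLast v) ≡ length v
  length-lengthenLast []          = refl
  length-lengthenLast (_ ∷ [])    = refl
  length-lengthenLast (_ ∷ t ∷ w) = cong suc (length-lengthenLast (t ∷ w))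

  countU-lengthenLast : ∀ v → countU (lengthenLast v) ≡ countU v
  countU-lengthenLast []              = refl
  countU-lengthenLast (up ∷ [])       = refl
  countU-lengthenLast (down _ ∷ [])   = refl
  countU-lengthenLast (up ∷ t ∷ w)     = cong suc (countU-lengthenLast (t ∷ w))
  countU-lengthenLast (down _ ∷ t ∷ w) = countU-lengthenLast (t ∷ w)

  -- After a down-step the path goes up, so its last step starts at height ≥ 2 and is not a D.
  mutual
    countD1-lengthenLast : ∀ h w → T (firstHit true (suc h) w) → countD1 (lengthenLast w) ≡ countD1 w
    countD1-lengthenLast h (up ∷ w) hw = trans (cong countD1 (lengthenLast-up w)) (countD1-lengthenLast′ h w hw)

    countD1-lengthenLast′ : ∀ h w → T (firstHit false (suc (suc h)) w) → countD1 (lengthenLast w) ≡ countD1 w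
    countD1-lengthenLast′ h (up ∷ w) hw =
      trans (cong countD1 (lengthenLast-up w)) (countD1-lengthenLast′ (suc h) w hw)
    countD1-lengthenLast′ h (down (suc j) ∷ [])        hw = refl
    countD1-lengthenLast′ h (down zero ∷ v@(_ ∷ _))    hw = cong suc (countD1-lengthenLastDown (suc (suc h)) zero v hw (λ ()))
    countD1-lengthenLast′ h (down (suc j) ∷ v@(_ ∷ _)) hw = countD1-lengthenLastDown (suc (suc h)) (suc j) v hw (λ ())

    countD1-lengthenLastDown : ∀ h j v → T (firstHitDown h j v) → v ≢ [] → countD1 (lengthenLast v) ≡ countD1 v
    countD1-lengthenLastDown (suc h)       (suc j) v  hv v≢[] = countD1-lengthenLastDown h j v hv v≢[]
    countD1-lengthenLastDown (suc (suc h)) zero    v  hv _    = countD1-lengthenLast h v hv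
    countD1-lengthenLastDown (suc zero)    zero    [] hv v≢[] = ⊥-elim (v≢[] refl)

  firstHit-afterDown⇒firstHit : ∀ h w → T (firstHit true h w) → T (firstHit false h w)
  firstHit-afterDown⇒firstHit h (up ∷ w) hw = hw

  firstHit⇒walk : ∀ v → T (firstHit false 1 v) → T (walk false 1 v)
  firstHit⇒walk v hv = subst (T ∘ walk false 1) (++-identityʳ v) (firstHit-++ false 1 v [] hv tt)

module Counting where

  open import Data.Nat using (_+_; _*_; _∸_; _≤_; _≤?_; _≡ᵇ_; z≤n)
  open import Data.Nat.Properties
    using (≤-irrelevant; ≡-irrelevant; m≤m+n; m+n∸m≡n; m+[n∸m]≡n; m≤n⇒m≤1+n; ≤-refl; ≤-antisym; ≰⇒>; 1+n≰n; ≡ᵇ⇒≡; ≡⇒≡ᵇ)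
  open import Data.Bool using (Bool; true; false; T; _∧_; if_then_else_)
  open import Data.Bool.Properties using (T-irrelevant)
  open import Data.Fin using (zero; suc)
  open import Data.Fin.Properties using (+↔⊎; *↔×; 0↔⊥; 1↔⊤)
  open import Data.Fin.Permutation using (↔⇒≡)
  open import Data.Sum using (_⊎_; inj₁; inj₂)
  open import Data.Sum.Function.Propositional using (_⊎-↔_)
  open import Data.Product.Function.NonDependent.Propositional using (_×-↔_)
  open import Data.Product.Function.Dependent.Propositional using (Σ-↔)
  open import Data.Unit using (⊤; tt)
  open import Data.Empty using (⊥-elim)
  open import Function.Bundles using (Inverse; mk↔ₛ′)
  open import Relation.Nullary using (yes; no; ¬_)
  open import Function.Properties.Inverse using (↔-sym; ↔-trans)
  open import Relation.Binary.PropositionalEquality using (_≡_; refl; sym; trans; cong; cong₂; subst)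

  Σ≤ : ℕ → (ℕ → Set) → Set
  Σ≤ n X = Σ ℕ λ i → i ≤ n × X i

  Σ≤-zero : ∀ {X} → Σ≤ 0 X ↔ X 0
  Σ≤-zero = mk↔ₛ′ (λ { (.0 , z≤n , x) → x }) (λ x → 0 , z≤n , x) (λ _ → refl) (λ { (.0 , z≤n , x) → refl })

  Σ≤-suc : ∀ n {X} → Σ≤ (suc n) X ↔ (Σ≤ n X ⊎ X (suc n))
  Σ≤-suc n {X} = mk↔ₛ′ to from to∘from from∘to
    where
    top : ∀ {i} → i ≤ suc n → ¬ i ≤ n → i ≡ suc n
    top i≤1+n i≰n = ≤-antisym i≤1+n (≰⇒> i≰n)
    to : Σ≤ (suc n) X → Σ≤ n X ⊎ X (suc n)
    to (i , i≤1+n , x) with i ≤? n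
    ... | yes i≤n = inj₁ (i , i≤n , x)
    ... | no  i≰n = inj₂ (subst X (top i≤1+n i≰n) x)
    from : Σ≤ n X ⊎ X (suc n) → Σ≤ (suc n) X
    from (inj₁ (i , i≤n , x)) = i , m≤n⇒m≤1+n i≤n , x
    from (inj₂ x)             = suc n , ≤-refl , x
    to∘from : ∀ y → to (from y) ≡ y
    to∘from (inj₁ (i , i≤n , x)) with i ≤? n
    ... | yes i≤n′ = cong (λ p → inj₁ (i , p , x)) (≤-irrelevant i≤n′ i≤n)
    ... | no  i≰n  = ⊥-elim (i≰n i≤n)
    to∘from (inj₂ x) with suc n ≤? n
    ... | yes 1+n≤n = ⊥-elim (1+n≰n 1+n≤n)
    ... | no  1+n≰n with top (≤-refl {suc n}) 1+n≰n
    ...   | refl = refl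
    from∘to : ∀ y → from (to y) ≡ y
    from∘to (i , i≤1+n , x) with i ≤? n
    ... | yes _ = cong (λ p → i , p , x) (≤-irrelevant _ i≤1+n)
    ... | no  i≰n with top i≤1+n i≰n
    ...   | refl = cong (λ p → suc n , p , x) (≤-irrelevant _ i≤1+n)

  Σ≤-count : ∀ n {X} f → (∀ i → i ≤ n → X i ↔ Fin (f i)) → Σ≤ n X ↔ Fin (sumUpTo _+_ n f)
  Σ≤-count zero    f X↔f = ↔-trans Σ≤-zero (X↔f 0 z≤n)
  Σ≤-count (suc n) f X↔f = ↔-trans (Σ≤-suc n)
    (↔-trans (Σ≤-count n f (λ i i≤n → X↔f i (m≤n⇒m≤1+n i≤n)) ⊎-↔ X↔f (suc n) ≤-refl) (↔-sym +↔⊎))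

  record Class : Set₁ where
    field
      Obj : Set
      degˣ degʸ degᶻ : Obj → ℕ

    degrees : Obj → ℕ × ℕ × ℕ
    degrees o = degˣ o , degʸ o , degᶻ o
  open Class public

  Layer : Class → ℕ → ℕ → ℕ → Set
  Layer X n k l = Σ (Obj X) λ o → degˣ X o ≡ n × degʸ X o ≡ k × degᶻ X o ≡ l

  Counted : Class → (ℕ → ℕ → ℕ → ℕ) → Set
  Counted X f = ∀ n k l → Layer X n k l ↔ Fin (f n k l)

  Layer-≡ : ∀ {X n k l} {o o′ : Layer X n k l} → proj₁ o ≡ proj₁ o′ → o ≡ o′
  Layer-≡ {o = o , a , b , c} {o′ = .o , a′ , b′ , c′} refl =
    cong (o ,_) (cong₂ _,_ (≡-irrelevant a a′) (cong₂ _,_ (≡-irrelevant b b′) (≡-irrelevant c c′)))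

  infixr 6 _⊞_
  infixr 7 _⊗_
  infix  4 _≃_

  _⊞_ : Class → Class → Class
  X ⊞ Y = record
    { Obj  = Obj X ⊎ Obj Y
    ; degˣ = λ { (inj₁ o) → degˣ X o ; (inj₂ o) → degˣ Y o }
    ; degʸ = λ { (inj₁ o) → degʸ X o ; (inj₂ o) → degʸ Y o }
    ; degᶻ = λ { (inj₁ o) → degᶻ X o ; (inj₂ o) → degᶻ Y o } }

  _⊗_ : Class → Class → Class
  X ⊗ Y = record
    { Obj  = Obj X × Obj Y
    ; degˣ = λ (o , o′) → degˣ X o + degˣ Y o′
    ; degʸ = λ (o , o′) → degʸ X o + degʸ Y o′
    ; degᶻ = λ (o , o′) → degᶻ X o + degᶻ Y o′ }

  atom : ℕ → ℕ → ℕ → Class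
  atom a b d = record { Obj = ⊤ ; degˣ = λ _ → a ; degʸ = λ _ → b ; degᶻ = λ _ → d }

  record _≃_ (X Y : Class) : Set where
    field
      bijection : Obj X ↔ Obj Y
      preserves : ∀ o → degrees Y (Inverse.to bijection o) ≡ degrees X o

  Layer-↔ : ∀ {X Y} → X ≃ Y → ∀ n k l → Layer X n k l ↔ Layer Y n k l
  Layer-↔ {X} {Y} X≃Y n k l = mk↔ₛ′
    (λ (o , a , b , c) → let p = preserves o in
      to o , trans (cong proj₁ p) a , trans (cong (proj₁ ∘ proj₂) p) b , trans (cong (proj₂ ∘ proj₂) p) c)
    (λ (o , a , b , c) → let p = back o in
      from o , trans (cong proj₁ p) a , trans (cong (proj₁ ∘ proj₂) p) b , trans (cong (proj₂ ∘ proj₂) p) c)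
    (λ _ → Layer-≡ {Y} (Inverse.strictlyInverseˡ bijection _))
    (λ _ → Layer-≡ {X} (Inverse.strictlyInverseʳ bijection _))
    where
    open _≃_ X≃Y
    open Inverse bijection using (to; from)
    back : ∀ o → degrees X (from o) ≡ degrees Y o
    back o = trans (sym (preserves (from o))) (cong (degrees Y) (Inverse.strictlyInverseˡ bijection o))

  count-≃ : ∀ {X Y f} → X ≃ Y → Counted Y f → Counted X f
  count-≃ X≃Y countY n k l = ↔-trans (Layer-↔ X≃Y n k l) (countY n k l)

  count-unique : ∀ {X f g} → Counted X f → Counted X g → ∀ n k l → f n k l ≡ g n k l
  count-unique count₁ count₂ n k l = ↔⇒≡ (↔-trans (↔-sym (count₁ n k l)) (count₂ n k l))

  count-⊞ : ∀ {X Y f g} → Counted X f → Counted Y g → Counted (X ⊞ Y) (λ n k l → f n k l + g n k l)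
  count-⊞ {X} {Y} countX countY n k l = ↔-trans split (↔-trans (countX n k l ⊎-↔ countY n k l) (↔-sym +↔⊎))
    where
    split : Layer (X ⊞ Y) n k l ↔ (Layer X n k l ⊎ Layer Y n k l)
    split = mk↔ₛ′
      (λ { (inj₁ o , p) → inj₁ (o , p) ; (inj₂ o , p) → inj₂ (o , p) })
      (λ { (inj₁ (o , p)) → inj₁ o , p ; (inj₂ (o , p)) → inj₂ o , p })
      (λ { (inj₁ _) → refl ; (inj₂ _) → refl })
      (λ { (inj₁ _ , _) → refl ; (inj₂ _ , _) → refl })

  indicator : ℕ → ℕ → ℕ → ℕ → ℕ → ℕ → ℕ
  indicator a b d n k l = if (a ≡ᵇ n) ∧ (b ≡ᵇ k) ∧ (d ≡ᵇ l) then 1 else 0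

  T↔Fin : ∀ β → T β ↔ Fin (if β then 1 else 0)
  T↔Fin true  = ↔-sym 1↔⊤
  T↔Fin false = ↔-sym 0↔⊥

  T-∧-↔ : ∀ β γ → T (β ∧ γ) ↔ (T β × T γ)
  T-∧-↔ true  γ = mk↔ₛ′ (tt ,_) proj₂ (λ _ → refl) (λ _ → refl)
  T-∧-↔ false γ = mk↔ₛ′ (λ ()) (λ ()) (λ ()) (λ ())

  T-≡ᵇ-↔ : ∀ m n → T (m ≡ᵇ n) ↔ (m ≡ n)
  T-≡ᵇ-↔ m n = mk↔ₛ′ (≡ᵇ⇒≡ m n) (≡⇒≡ᵇ m n) (λ _ → ≡-irrelevant _ _) (λ _ → T-irrelevant _ _)

  count-atom : ∀ a b d → Counted (atom a b d) (indicator a b d)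
  count-atom a b d n k l = ↔-trans (mk↔ₛ′ proj₂ (tt ,_) (λ _ → refl) (λ _ → refl)) (↔-trans (↔-sym
    (↔-trans (T-∧-↔ (a ≡ᵇ n) _) (T-≡ᵇ-↔ a n ×-↔ ↔-trans (T-∧-↔ (b ≡ᵇ k) _) (T-≡ᵇ-↔ b k ×-↔ T-≡ᵇ-↔ d l))))
    (T↔Fin _))

  cauchy : (ℕ → ℕ → ℕ → ℕ) → (ℕ → ℕ → ℕ → ℕ) → ℕ → ℕ → ℕ → ℕ
  cauchy f g n k l = sumUpTo _+_ n λ i → sumUpTo _+_ k λ j → sumUpTo _+_ l λ m →
    f i j m * g (n ∸ i) (k ∸ j) (l ∸ m)

  Splittings : Class → Class → ℕ → ℕ → ℕ → Set
  Splittings X Y n k l =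
    Σ≤ n λ i → Σ≤ k λ j → Σ≤ l λ m → Layer X i j m × Layer Y (n ∸ i) (k ∸ j) (l ∸ m)

  Layer-⊗-↔ : ∀ X Y n k l → Layer (X ⊗ Y) n k l ↔ Splittings X Y n k l
  Layer-⊗-↔ X Y n k l = mk↔ₛ′ to from to∘from (λ _ → Layer-≡ {X ⊗ Y} refl)
    where
    ≤-of : ∀ {a b n} → a + b ≡ n → a ≤ n
    ≤-of {a} {b} refl = m≤m+n a b
    ∸-of : ∀ {a b n} → a + b ≡ n → b ≡ n ∸ a
    ∸-of {a} {b} refl = sym (m+n∸m≡n a b)
    +-of : ∀ {a b i n} → i ≤ n → a ≡ i → b ≡ n ∸ i → a + b ≡ n
    +-of i≤n refl refl = m+[n∸m]≡n i≤n
    to : Layer (X ⊗ Y) n k l → Splittings X Y n k l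
    to ((o , o′) , e₁ , e₂ , e₃) =
      degˣ X o , ≤-of e₁ , degʸ X o , ≤-of e₂ , degᶻ X o , ≤-of e₃ ,
      (o , refl , refl , refl) , (o′ , ∸-of e₁ , ∸-of e₂ , ∸-of e₃)
    from : Splittings X Y n k l → Layer (X ⊗ Y) n k l
    from (i , p , j , q , m , r , (o , a₁ , a₂ , a₃) , (o′ , b₁ , b₂ , b₃)) =
      (o , o′) , +-of p a₁ b₁ , +-of q a₂ b₂ , +-of r a₃ b₃
    to∘from : ∀ s → to (from s) ≡ s
    to∘from (_ , p , _ , q , _ , r , (o , refl , refl , refl) , (o′ , b₁ , b₂ , b₃))
      rewrite ≤-irrelevant (≤-of (+-of p refl b₁)) p | ≤-irrelevant (≤-of (+-of q refl b₂)) q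
            | ≤-irrelevant (≤-of (+-of r refl b₃)) r =
      cong (λ o″ → _ , p , _ , q , _ , r , (o , refl , refl , refl) , o″) (Layer-≡ {Y} refl)

  count-⊗ : ∀ {X Y f g} → Counted X f → Counted Y g → Counted (X ⊗ Y) (cauchy f g)
  count-⊗ {X} {Y} countX countY n k l = ↔-trans (Layer-⊗-↔ X Y n k l)
    (Σ≤-count n _ λ i _ → Σ≤-count k _ λ j _ → Σ≤-count l _ λ m _ →
       ↔-trans (countX i j m ×-↔ countY (n ∸ i) (k ∸ j) (l ∸ m)) (↔-sym *↔×))

  countTrue : ∀ c → (Fin c → Bool) → ℕ
  countTrue zero    β = 0
  countTrue (suc c) β = (if β zero then 1 else 0) + countTrue c (β ∘ suc)

  Σ-T-↔ : ∀ c (β : Fin c → Bool) → Σ (Fin c) (T ∘ β) ↔ Fin (countTrue c β)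
  Σ-T-↔ zero    β = mk↔ₛ′ (λ ()) (λ ()) (λ ()) (λ ())
  Σ-T-↔ (suc c) β = ↔-trans split (↔-trans (T↔Fin (β zero) ⊎-↔ Σ-T-↔ c (β ∘ suc)) (↔-sym +↔⊎))
    where
    split : Σ (Fin (suc c)) (T ∘ β) ↔ (T (β zero) ⊎ Σ (Fin c) (T ∘ β ∘ suc))
    split = mk↔ₛ′
      (λ { (zero , t) → inj₁ t ; (suc i , t) → inj₂ (i , t) })
      (λ { (inj₁ t) → zero , t ; (inj₂ (i , t)) → suc i , t })
      (λ { (inj₁ _) → refl ; (inj₂ _) → refl })
      (λ { (zero , _) → refl ; (suc _ , _) → refl })

  count-Σ-T : ∀ {A : Set} {c} (A↔c : A ↔ Fin c) (β : A → Bool) →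
              Σ A (T ∘ β) ↔ Fin (countTrue c (β ∘ Inverse.from A↔c))
  count-Σ-T A↔c β = ↔-trans (Σ-↔ A↔c transport) (Σ-T-↔ _ _)
    where
    open Inverse A↔c using (from; strictlyInverseʳ)
    transport : ∀ {a} → T (β a) ↔ T (β (from (Inverse.to A↔c a)))
    transport {a} = mk↔ₛ′ (subst (T ∘ β) (sym (strictlyInverseʳ a))) (subst (T ∘ β) (strictlyInverseʳ a))
                          (λ _ → T-irrelevant _ _) (λ _ → T-irrelevant _ _)

  Σ-T-≡ : ∀ {A : Set} {β : A → Bool} {s s′ : Σ A (T ∘ β)} → proj₁ s ≡ proj₁ s′ → s ≡ s′
  Σ-T-≡ {s = a , t} {s′ = .a , t′} refl = cong (a ,_) (T-irrelevant t t′)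

module Decomposition where

  open import Data.Bool using (Bool; true; false; T)
  open import Data.Bool.Properties using (T-irrelevant)
  open import Data.List using (List; []; _∷_; _++_; length)
  open import Data.List.Properties using (length-++; ++-cancelˡ)
  open import Data.Nat.Properties using (suc-injective)
  open import Data.Sum using (inj₁; inj₂)
  open import Data.Unit using (tt)
  open import Data.Empty using (⊥-elim)
  open import Data.Product.Function.NonDependent.Propositional using (_×-↔_)
  open import Data.Product.Function.Dependent.Propositional using (Σ-↔)
  open import Data.Product.Algebra using (Σ-assoc-alt)
  open import Function.Bundles using (Inverse; mk↔ₛ′)
  open import Function.Properties.Inverse using (↔-refl; ↔-sym; ↔-trans)
  open import Relation.Binary.PropositionalEquality using (_≡_; refl; sym; trans; cong; cong₂)
  open FirstPassages
  open Counting

  words : (List Step → Bool) → Class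
  words p = record
    { Obj = Σ (List Step) (T ∘ p) ; degˣ = length ∘ proj₁ ; degʸ = countU ∘ proj₁ ; degᶻ = countD1 ∘ proj₁ }

  words-≡ : ∀ {p} {w w′ : Obj (words p)} → proj₁ w ≡ proj₁ w′ → w ≡ w′
  words-≡ {w = w , h} {w′ = .w , h′} refl = cong (w ,_) (T-irrelevant h h′)

  Dyck Tail Rest Passage Passage↓ Passage₂ : Class
  Dyck     = words isAirDyck
  Tail     = words (walk false 1)
  Rest     = words (walk true 0)
  Passage  = words (firstHit false 1)
  Passage↓ = words (firstHit true 1)
  Passage₂ = words (firstHit false 2)

  Passage⁺ : Class
  Passage⁺ = record Passage { degᶻ = countD1 ∘ lengthenLast ∘ proj₁ }

  Dyck≃U⊗Tail : Dyck ≃ atom 1 1 0 ⊗ Tail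
  Dyck≃U⊗Tail = record
    { bijection = mk↔ₛ′ (λ { (up ∷ w , h) → tt , (w , h) }) (λ (_ , (w , h)) → up ∷ w , h)
                        (λ _ → refl) (λ { (up ∷ _ , _) → refl })
    ; preserves = λ { (up ∷ _ , _) → refl } }

  Passage↓≃U⊗Passage₂ : Passage↓ ≃ atom 1 1 0 ⊗ Passage₂
  Passage↓≃U⊗Passage₂ = record
    { bijection = mk↔ₛ′ (λ { (up ∷ w , h) → tt , (w , h) }) (λ (_ , (w , h)) → up ∷ w , h)
                        (λ _ → refl) (λ { (up ∷ _ , _) → refl })
    ; preserves = λ { (up ∷ _ , _) → refl } }

  Rest≃1⊞Dyck : Rest ≃ atom 0 0 0 ⊞ Dyck
  Rest≃1⊞Dyck = record
    { bijection = mk↔ₛ′ (λ { ([] , _) → inj₁ tt ; (up ∷ w , h) → inj₂ (up ∷ w , h) })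
                        (λ { (inj₁ _) → [] , tt ; (inj₂ (up ∷ w , h)) → up ∷ w , h })
                        (λ { (inj₁ _) → refl ; (inj₂ (up ∷ _ , _)) → refl })
                        (λ { ([] , _) → refl ; (up ∷ _ , _) → refl })
    ; preserves = λ { ([] , _) → refl ; (up ∷ _ , _) → refl } }

  Passage≃D⊞Passage↓ : Passage ≃ atom 1 0 1 ⊞ Passage↓
  Passage≃D⊞Passage↓ = record
    { bijection = mk↔ₛ′ (λ { (down zero ∷ [] , _) → inj₁ tt ; (up ∷ w , h) → inj₂ (up ∷ w , h) })
                        (λ { (inj₁ _) → down zero ∷ [] , tt ; (inj₂ (up ∷ w , h)) → up ∷ w , h })
                        (λ { (inj₁ _) → refl ; (inj₂ (up ∷ _ , _)) → refl })
                        (λ { (down zero ∷ [] , _) → refl ; (up ∷ _ , _) → refl })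
    ; preserves = λ { (down zero ∷ [] , _) → refl ; (up ∷ _ , _) → refl } }

  Passage⁺≃x⊞Passage↓ : Passage⁺ ≃ atom 1 0 0 ⊞ Passage↓
  Passage⁺≃x⊞Passage↓ = record
    { bijection = mk↔ₛ′ (λ { (down zero ∷ [] , _) → inj₁ tt ; (up ∷ w , h) → inj₂ (up ∷ w , h) })
                        (λ { (inj₁ _) → down zero ∷ [] , tt ; (inj₂ (up ∷ w , h)) → up ∷ w , h })
                        (λ { (inj₁ _) → refl ; (inj₂ (up ∷ _ , _)) → refl })
                        (λ { (down zero ∷ [] , _) → refl ; (up ∷ _ , _) → refl })
    ; preserves = λ { (down zero ∷ [] , _) → refl
                    ; (up ∷ w , h) → cong (λ d → suc (length w) , suc (countU w) , d)
                                          (sym (countD1-lengthenLast 0 (up ∷ w) h)) } }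

  Tail≃Passage⊗Rest : Tail ≃ Passage ⊗ Rest
  Tail≃Passage⊗Rest = record { bijection = mk↔ₛ′ to from to∘from from∘to ; preserves = preserves }
    where
    to : Obj Tail → Obj (Passage ⊗ Rest)
    to (w , h) with walk-split false 0 w h
    ... | v , r , _ , hv , hr = (v , hv) , (r , hr)
    from : Obj (Passage ⊗ Rest) → Obj Tail
    from ((v , hv) , (r , hr)) = v ++ r , firstHit-++ false 1 v r hv hr
    from∘to : ∀ w → from (to w) ≡ w
    from∘to (w , h) with walk-split false 0 w h
    ... | v , r , refl , hv , hr = words-≡ {walk false 1} refl
    to∘from : ∀ s → to (from s) ≡ s
    to∘from ((v , hv) , (r , hr)) with walk-split false 0 (v ++ r) (firstHit-++ false 1 v r hv hr)
    ... | v′ , r′ , eq , hv′ , hr′ with firstHit-prefix-unique false 1 v′ v r′ r hv′ hv (sym eq)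
    ...   | refl = cong₂ _,_ (words-≡ {firstHit false 1} refl) (words-≡ {walk true 0} (++-cancelˡ v r′ r (sym eq)))
    preserves : ∀ w → degrees (Passage ⊗ Rest) (to w) ≡ degrees Tail w
    preserves (w , h) with walk-split false 0 w h
    ... | v , r , refl , _ , _ = sym (cong₂ _,_ (length-++ v) (cong₂ _,_ (countU-++ v r) (countD1-++ v r)))

  Passage₂≃Passage⁺⊞Passage⊗Passage↓ : Passage₂ ≃ Passage⁺ ⊞ Passage ⊗ Passage↓
  Passage₂≃Passage⁺⊞Passage⊗Passage↓ = record { bijection = mk↔ₛ′ to from to∘from from∘to ; preserves = preserves }
    where
    to : Obj Passage₂ → Obj (Passage⁺ ⊞ Passage ⊗ Passage↓)
    to (w , h) with raisedFirstHit false 0 w h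
    ... | jumps v _ hv          = inj₁ (v , hv)
    ... | touches v w′ _ hv hw′ = inj₂ ((v , hv) , (w′ , hw′))
    from : Obj (Passage⁺ ⊞ Passage ⊗ Passage↓) → Obj Passage₂
    from (inj₁ (v , hv))               = lengthenLast v , firstHit-lengthenLast false 1 v hv
    from (inj₂ ((v , hv) , (w′ , hw′))) = v ++ w′ , firstHit-raise-++ false 1 v w′ hv hw′
    from∘to : ∀ w → from (to w) ≡ w
    from∘to (w , h) with raisedFirstHit false 0 w h
    ... | jumps _ refl _        = words-≡ {firstHit false 2} refl
    ... | touches _ _ refl _ _ = words-≡ {firstHit false 2} refl
    to∘from : ∀ s → to (from s) ≡ s
    to∘from (inj₁ (v , hv)) with raisedFirstHit false 0 (lengthenLast v) (firstHit-lengthenLast false 1 v hv)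
    ... | jumps v′ eq _           = cong inj₁ (words-≡ {firstHit false 1} (sym (lengthenLast-injective v v′ eq)))
    ... | touches v′ w′ eq hv′ hw′ = ⊥-elim (lengthenLast-≢-++ false 1 v v′ w′ hv hv′ hw′ eq)
    to∘from (inj₂ ((v , hv) , (w′ , hw′))) with raisedFirstHit false 0 (v ++ w′) (firstHit-raise-++ false 1 v w′ hv hw′)
    ... | jumps v′ eq hv′ = ⊥-elim (lengthenLast-≢-++ false 1 v′ v w′ hv′ hv hw′ (sym eq))
    ... | touches v′ w″ eq hv′ _ with firstHit-prefix-unique false 1 v′ v w″ w′ hv′ hv (sym eq)
    ...   | refl = cong inj₂ (cong₂ _,_ (words-≡ {firstHit false 1} refl)
                                        (words-≡ {firstHit true 1} (++-cancelˡ v w″ w′ (sym eq))))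
    preserves : ∀ w → degrees (Passage⁺ ⊞ Passage ⊗ Passage↓) (to w) ≡ degrees Passage₂ w
    preserves (w , h) with raisedFirstHit false 0 w h
    ... | jumps v refl _ = sym (cong₂ _,_ (length-lengthenLast v) (cong (_, countD1 (lengthenLast v)) (countU-lengthenLast v)))
    ... | touches v w′ refl _ _ =
      sym (cong₂ _,_ (length-++ v) (cong₂ _,_ (countU-++ v w′) (countD1-++ v w′)))

  T-good-↔ : ∀ n k l w →
    T (good n k l w) ↔ (T (isAirDyck w) × length w ≡ n × countU w ≡ k × countD1 w ≡ l)
  T-good-↔ n k l w = ↔-trans (T-∧-↔ _ _) (↔-refl ×-↔ ↔-trans (T-∧-↔ _ _)
    (T-≡ᵇ-↔ _ _ ×-↔ ↔-trans (T-∧-↔ _ _) (T-≡ᵇ-↔ _ _ ×-↔ T-≡ᵇ-↔ _ _)))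

  Layer-Dyck↔Paths : ∀ n k l → Layer Dyck n k l ↔ Paths n k l
  Layer-Dyck↔Paths n k l = ↔-trans Σ-assoc-alt (Σ-↔ ↔-refl λ {w} → ↔-sym (T-good-↔ n k l w))

  upThen : (List Step → Bool) → List Step → Bool
  upThen p (up ∷ v) = p v
  upThen p _        = false

  Layer-↔-upThen : ∀ p q → (∀ v → T (p v) → T (q (up ∷ v))) → ∀ n k l →
    Layer (words p) n k l ↔ Σ (Layer (words q) (suc n) (suc k) l) (T ∘ upThen p ∘ proj₁ ∘ proj₁)
  Layer-↔-upThen p q p⇒q n k l = mk↔ₛ′ to from
    (λ { (((up ∷ _ , _) , _) , _) → Σ-T-≡ (Layer-≡ {words q} (words-≡ {q} refl)) })
    (λ _ → Layer-≡ {words p} (words-≡ {p} refl))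
    where
    to : Layer (words p) n k l → Σ (Layer (words q) (suc n) (suc k) l) (T ∘ upThen p ∘ proj₁ ∘ proj₁)
    to ((v , h) , e₁ , e₂ , e₃) = ((up ∷ v , p⇒q v h) , cong suc e₁ , cong suc e₂ , e₃) , h
    from : Σ (Layer (words q) (suc n) (suc k) l) (T ∘ upThen p ∘ proj₁ ∘ proj₁) → Layer (words p) n k l
    from (((up ∷ v , _) , e₁ , e₂ , e₃) , h) = (v , h) , suc-injective e₁ , suc-injective e₂ , e₃

  counted-upThen : ∀ p q {f} → (∀ v → T (p v) → T (q (up ∷ v))) → Counted (words q) f →
                   Σ (ℕ → ℕ → ℕ → ℕ) (Counted (words p))
  counted-upThen p q p⇒q count =
    (λ n k l → countTrue _ (upThen p ∘ proj₁ ∘ proj₁ ∘ Inverse.from (count (suc n) (suc k) l))) ,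
    λ n k l → ↔-trans (Layer-↔-upThen p q p⇒q n k l) (count-Σ-T (count (suc n) (suc k) l) _)

open import Data.Nat using (_≡ᵇ_)
open import Data.Integer.Properties using (pos-+; pos-*)
open import Data.Bool using (true; false; _∧_; if_then_else_)
open import Function.Properties.Inverse using (↔-sym; ↔-trans)
open import Relation.Binary.PropositionalEquality using (_≡_; refl; cong; cong₂; trans)
import Data.Nat as ℕ
import Data.Integer as ℤ
open TrivariateSeries
open FirstPassages
open Counting
open Decomposition

cast : (ℕ → ℕ → ℕ → ℕ) → PS
cast f n k l = + f n k l

cast-+ : ∀ f g → cast (λ n k l → f n k l ℕ.+ g n k l) ≈ cast f + cast g
cast-+ f g n k l = pos-+ (f n k l) (g n k l)

cast-cauchy : ∀ f g → cast (cauchy f g) ≈ cast f * cast g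
cast-cauchy f g = ≈-trans (λ n k l → trans (cast-sum n _) (sumTo-cong n λ i → trans (cast-sum k _)
    (sumTo-cong k λ j → trans (cast-sum l _) (sumTo-cong l λ m → pos-* (f i j m) _))))
  (⊛≈* (cast f) (cast g))
  where
  cast-sum : ∀ n h → + sumUpTo ℕ._+_ n h ≡ sumTo n (+_ ∘ h)
  cast-sum zero    h = refl
  cast-sum (suc n) h = trans (pos-+ (sumUpTo ℕ._+_ n h) (h (suc n))) (cong (ℤ._+ + h (suc n)) (cast-sum n h))
  sumTo-cong : ∀ n {h h′} → (∀ i → h i ≡ h′ i) → sumTo n h ≡ sumTo n h′
  sumTo-cong zero    h≡h′ = h≡h′ 0
  sumTo-cong (suc n) h≡h′ = cong₂ ℤ._+_ (sumTo-cong n h≡h′) (h≡h′ (suc n))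

cast-indicator : ∀ a b d → cast (indicator a b d) ≈ κ (+ 1) * x ^ a * y ^ b * z ^ d
cast-indicator a b d = ≈-trans (λ n k l → +-if ((a ≡ᵇ n) ∧ (b ≡ᵇ k) ∧ (d ≡ᵇ l))) (mon≈ (+ 1) a b d)
  where
  +-if : ∀ β → + (if β then 1 else 0) ≡ (if β then + 1 else + 0)
  +-if true  = refl
  +-if false = refl

module GeneratingFunctions (a : ℕ → ℕ → ℕ → ℕ) (a↔Paths : ∀ n k ℓ → Fin (a n k ℓ) ↔ Paths n k ℓ) where

  count-Dyck : Counted Dyck a
  count-Dyck n k l = ↔-trans (Layer-Dyck↔Paths n k l) (↔-sym (a↔Paths n k l))

  -- Only the paths come with a count; the other classes are counted as decidable subclasses of them.
  private
    counted-Passage : Σ _ (Counted Passage)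
    counted-Passage = counted-upThen (firstHit false 1) isAirDyck firstHit⇒walk count-Dyck

    counted-Passage↓ : Σ _ (Counted Passage↓)
    counted-Passage↓ = counted-upThen (firstHit true 1) isAirDyck
      (λ v → firstHit⇒walk v ∘ firstHit-afterDown⇒firstHit 1 v) count-Dyck

    counted-Passage₂ : Σ _ (Counted Passage₂)
    counted-Passage₂ = counted-upThen (firstHit false 2) (firstHit true 1) (λ _ h → h) (proj₂ counted-Passage↓)

  e c g : ℕ → ℕ → ℕ → ℕ
  e = proj₁ counted-Passage
  c = proj₁ counted-Passage↓
  g = proj₁ counted-Passage₂

  infixl 6 _⊕ℕ_
  _⊕ℕ_ : (ℕ → ℕ → ℕ → ℕ) → (ℕ → ℕ → ℕ → ℕ) → ℕ → ℕ → ℕ → ℕ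
  (f ⊕ℕ f′) n k l = f n k l ℕ.+ f′ n k l

  a-equation : ∀ n k l → a n k l ≡ cauchy (indicator 1 1 0) (cauchy e (indicator 0 0 0 ⊕ℕ a)) n k l
  a-equation = count-unique count-Dyck
    (count-≃ Dyck≃U⊗Tail (count-⊗ (count-atom 1 1 0)
      (count-≃ Tail≃Passage⊗Rest (count-⊗ (proj₂ counted-Passage)
        (count-≃ Rest≃1⊞Dyck (count-⊞ (count-atom 0 0 0) count-Dyck))))))

  e-equation : ∀ n k l → e n k l ≡ (indicator 1 0 1 ⊕ℕ c) n k l
  e-equation = count-unique (proj₂ counted-Passage)
    (count-≃ Passage≃D⊞Passage↓ (count-⊞ (count-atom 1 0 1) (proj₂ counted-Passage↓)))

  c-equation : ∀ n k l → c n k l ≡ cauchy (indicator 1 1 0) g n k l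
  c-equation = count-unique (proj₂ counted-Passage↓)
    (count-≃ Passage↓≃U⊗Passage₂ (count-⊗ (count-atom 1 1 0) (proj₂ counted-Passage₂)))

  g-equation : ∀ n k l → g n k l ≡ (indicator 1 0 0 ⊕ℕ c ⊕ℕ cauchy e c) n k l
  g-equation = count-unique (proj₂ counted-Passage₂)
    (count-≃ Passage₂≃Passage⁺⊞Passage⊗Passage↓
      (count-⊞ (count-≃ Passage⁺≃x⊞Passage↓ (count-⊞ (count-atom 1 0 0) (proj₂ counted-Passage↓)))
               (count-⊗ (proj₂ counted-Passage) (proj₂ counted-Passage↓))))

  A E C G : PS
  A = cast a
  E = cast e
  C = cast c
  G = cast g

  private
    cast-equation : ∀ {f f′} → (∀ n k l → f n k l ≡ f′ n k l) → cast f ≈ cast f′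
    cast-equation f≡f′ n k l = cong +_ (f≡f′ n k l)

  open import Relation.Binary.Reasoning.Setoid setoid

  A-equation : A ≈ x * y * E * (1# + A)
  A-equation = begin
    A                                                              ≈⟨ cast-equation a-equation ⟩
    cast (cauchy (indicator 1 1 0) (cauchy e (indicator 0 0 0 ⊕ℕ a)))
      ≈⟨ ≈-trans (cast-cauchy (indicator 1 1 0) (cauchy e (indicator 0 0 0 ⊕ℕ a))) (*-cong (cast-indicator 1 1 0)
           (≈-trans (cast-cauchy e (indicator 0 0 0 ⊕ℕ a))
                    (*-congˡ {E} (≈-trans (cast-+ (indicator 0 0 0) a) (+-congʳ {A} (cast-indicator 0 0 0)))))) ⟩
    κ (+ 1) * x ^ 1 * y ^ 1 * z ^ 0 * (E * (κ (+ 1) * x ^ 0 * y ^ 0 * z ^ 0 + A))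
      ≈⟨ solve 5 (λ x y z E A → monₚ (+ 1) 1 1 0 x y z :* (E :* (monₚ (+ 1) 0 0 0 x y z :+ A))
                                := x :* y :* E :* (con (+ 1) :+ A)) ≈-refl x y z E A ⟩
    x * y * E * (1# + A)                                           ∎

  E-equation : E ≈ x * z + C
  E-equation = begin
    E                                          ≈⟨ cast-equation e-equation ⟩
    cast (indicator 1 0 1 ⊕ℕ c)                ≈⟨ ≈-trans (cast-+ (indicator 1 0 1) c) (+-congʳ {C} (cast-indicator 1 0 1)) ⟩
    κ (+ 1) * x ^ 1 * y ^ 0 * z ^ 1 + C
      ≈⟨ solve 4 (λ x y z C → monₚ (+ 1) 1 0 1 x y z :+ C := x :* z :+ C) ≈-refl x y z C ⟩
    x * z + C                                  ∎

  C-equation : C ≈ x * y * G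
  C-equation = begin
    C                                          ≈⟨ cast-equation c-equation ⟩
    cast (cauchy (indicator 1 1 0) g)          ≈⟨ ≈-trans (cast-cauchy (indicator 1 1 0) g) (*-congʳ {G} (cast-indicator 1 1 0)) ⟩
    κ (+ 1) * x ^ 1 * y ^ 1 * z ^ 0 * G
      ≈⟨ solve 4 (λ x y z G → monₚ (+ 1) 1 1 0 x y z :* G := x :* y :* G) ≈-refl x y z G ⟩
    x * y * G                                  ∎

  G-equation : G ≈ x + C + E * C
  G-equation = begin
    G                                          ≈⟨ cast-equation g-equation ⟩
    cast (indicator 1 0 0 ⊕ℕ c ⊕ℕ cauchy e c)
      ≈⟨ ≈-trans (cast-+ (indicator 1 0 0 ⊕ℕ c) (cauchy e c))
           (+-cong (≈-trans (cast-+ (indicator 1 0 0) c) (+-congʳ {C} (cast-indicator 1 0 0))) (cast-cauchy e c)) ⟩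
    κ (+ 1) * x ^ 1 * y ^ 0 * z ^ 0 + C + E * C
      ≈⟨ solve 5 (λ x y z C E → monₚ (+ 1) 1 0 0 x y z :+ C :+ E :* C := x :+ C :+ E :* C) ≈-refl x y z C E ⟩
    x + C + E * C                              ∎

theorem2 : (a : ℕ → ℕ → ℕ → ℕ)
           → (∀ n k ℓ → Fin (a n k ℓ) ↔ Paths n k ℓ)
           → Σ PS (λ S → IsSqrtOf S Rpoly
               × (Den ⊛ (λ n k ℓ → + (a n k ℓ)) ≈ Pnum ⊖ S))
theorem2 a a↔Paths =
  Pnum ⊖ Den ⊛ A ,
  sqrt-from-system A-equation E-equation C-equation G-equation ,
  solve 2 (λ p q → q := p :- (p :- q)) ≈-refl Pnum (Den ⊛ A)
  where
  open GeneratingFunctions a a↔Paths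
  open Solution
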